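{- Let $c=(c_1,\dots,c_k)$ be a composition of $n$ with $k\ge2$, and let $m\in\{1,\dots,k-1\}$. Let $c^m=(c_1,\dots,c_{m-1},c_m+c_{m+1},c_{m+2},\dots,c_k)$, $c^L=(c_2,\dots,c_k)$ and $c^R=(c_1,\dots,c_{k-1})$. Then \[ g_{c^m}(q)=\left(\frac{c_1+\cdots+c_m}{c_1+\cdots+c_k}\right)g_{c^R}(q)+\left(\frac{c_{m+1}+\cdots+c_k}{c_1+\cdots+c_k}\right)q^{c_1}g_{c^L}(q). \]
   Context: For a composition $c=(c_1,\dots,c_k)$ (positive integers), the composition polynomial is \[ g_c(q) := \int_{q}^{1} \int_{q}^{t_k} \cdots \int_{q}^{t_2} t_1^{c_1-1}\cdots t_k^{c_k-1}\, dt_1\cdots dt_k . \]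
   Formalization: The variable q of the composition polynomials ranges over the rationals. -}

module Defs where

open import Data.Nat as ℕ using (ℕ; zero; suc; _∸_)
open import Data.Integer using (+_)
open import Data.List using (List; []; _∷_; _++_; foldl; replicate; length; take; drop)
open import Data.Rational using (ℚ; 0ℚ; 1ℚ; _+_; _*_; _-_; _/_)

-- Polynomials in one variable over ℚ: coefficient lists, constant term first.
Poly : Set
Poly = List ℚ

eval : Poly → ℚ → ℚ
eval []       x = 0ℚ
eval (a ∷ as) x = a + x * eval as x

shift : ℕ → Poly → Poly
shift n P = replicate n 0ℚ ++ P

-- antiderivative vanishing at 0; i = current exponent
antiFrom : ℕ → Poly → Poly
antiFrom i []       = []
antiFrom i (a ∷ as) = (a * ((+ 1) / suc i)) ∷ antiFrom (suc i) as

anti : Poly → Poly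
anti P = 0ℚ ∷ antiFrom 0 P

subConst : ℚ → Poly → Poly
subConst r []       = 0ℚ - r ∷ []
subConst r (a ∷ as) = (a - r) ∷ as

integ : ℚ → Poly → Poly
integ q P = subConst (eval (anti P) q) (anti P)

-- H q (c₁,…,cⱼ) is the polynomial
--   x ↦ ∫_q^x ∫_q^{tⱼ} ⋯ ∫_q^{t₂} t₁^{c₁-1}⋯tⱼ^{cⱼ-1} dt₁⋯dtⱼ   (with tⱼ = x's variable)
iterStep : ℚ → Poly → ℕ → Poly
iterStep q P c = integ q (shift (c ∸ 1) P)

H : ℚ → List ℕ → Poly
H q cs = foldl (iterStep q) (1ℚ ∷ []) cs

g : List ℕ → ℚ → ℚ
g c q = eval (H q c) 1ℚ

pow : ℚ → ℕ → ℚ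
pow q zero    = 1ℚ
pow q (suc n) = q * pow q n

-- a / b for naturals (only used with b > 0)
frac : ℕ → ℕ → ℚ
frac a zero    = 0ℚ
frac a (suc b) = (+ a) / suc b

headD : List ℕ → ℕ
headD []      = 0
headD (x ∷ _) = x

cL : List ℕ → List ℕ
cL c = drop 1 c

cR : List ℕ → List ℕ
cR c = take (length c ∸ 1) c

-- Write H_c(x) for the iterated integral defining g_c with upper limit x, so g_c(q) = H_c(1). For a
-- composition c of n with positive parts there is an Euler-type identity
--   n H_c(x) + q^{c₁} H_{c^L}(x) = x^{c_k} H_{c^R}(x),
-- proved by induction along c: each integration x ↦ ∫_q^x t^{d-1} (·) dt preserves linear relations,
-- and integration by parts, d ∫_q^x t^{d-1} F + ∫_q^x t^d F′ = x^d F(x) for F(q) = 0, adds d to the weight.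
-- Applying the identity to (c₁,…,c_m) and integrating further along c_{m+1},…,c_k, where the factor
-- x^{c_m} merges with t^{c_{m+1}-1}, gives (c₁+⋯+c_m) g_c + q^{c₁} g_{c^L} = g_{c^m}; the identity for c
-- itself at x = 1 gives n g_c + q^{c₁} g_{c^L} = g_{c^R}. Eliminating g_c yields the corollary.

module Submission where

open import Defs
open import Data.Nat as ℕ using (ℕ; zero; suc; _+_; _∸_; _<_; s≤s; z≤n; compare; less; equal; greater)
import Data.Nat.Properties as ℕ
open import Data.Nat.ListAction using (sum)
open import Data.Nat.ListAction.Properties using (sum-++)
open import Data.Integer as ℤ using (+_)
import Data.Integer.Properties as ℤ
open import Data.Integer.Tactic.RingSolver using (solve-∀)
open import Data.List using (List; []; _∷_; _++_; _∷ʳ_; foldl; drop; take; length; initLast; _∷ʳ′_)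
open import Data.List.Properties using (foldl-++; ++-assoc; length-++)
open import Data.List.Relation.Unary.All as All using (All; []; _∷_)
open import Data.List.Relation.Unary.All.Properties using (++⁻ˡ; ++⁻ʳ; ∷ʳ⁺)
open import Data.Rational using (ℚ; 0ℚ; 1ℚ; _/_; toℚᵘ) renaming (_+_ to _+ℚ_; _*_ to _*ℚ_; _-_ to _-ℚ_)
open import Data.Rational.Properties using (toℚᵘ-fromℚᵘ; toℚᵘ-injective; toℚᵘ-homo-+; toℚᵘ-homo-*)
import Data.Rational.Properties as ℚ
open import Data.Rational.Solver using (module +-*-Solver)
open +-*-Solver
open import Data.Rational.Unnormalised as ℚᵘ using (mkℚᵘ; _≃_; *≡*)
import Data.Rational.Unnormalised.Properties as ℚᵘ
open import Relation.Binary.Bundles using (Setoid)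
open import Relation.Binary.PropositionalEquality
import Relation.Binary.Reasoning.Setoid as SetoidReasoning

fromℕ : ℕ → ℚ
fromℕ n = + n / 1

1/[1+_] : ℕ → ℚ
1/[1+ k ] = + 1 / suc k

toℚᵘ-/ : ∀ a b → toℚᵘ (+ a / suc b) ≃ mkℚᵘ (+ a) b
toℚᵘ-/ a b = toℚᵘ-fromℚᵘ (mkℚᵘ (+ a) b)

fromℕ-+ : ∀ m n → fromℕ (m + n) ≡ fromℕ m +ℚ fromℕ n
fromℕ-+ m n = toℚᵘ-injective (begin
  toℚᵘ (fromℕ (m + n))                ≈⟨ toℚᵘ-/ (m + n) 0 ⟩
  mkℚᵘ (+ m ℤ.+ + n) 0                ≈⟨ *≡* (cross (+ m) (+ n)) ⟩
  mkℚᵘ (+ m) 0 ℚᵘ.+ mkℚᵘ (+ n) 0      ≈⟨ ℚᵘ.+-cong (toℚᵘ-/ m 0) (toℚᵘ-/ n 0) ⟨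
  toℚᵘ (fromℕ m) ℚᵘ.+ toℚᵘ (fromℕ n)  ≈⟨ toℚᵘ-homo-+ (fromℕ m) (fromℕ n) ⟨
  toℚᵘ (fromℕ m +ℚ fromℕ n)           ∎)
  where
  open ℚᵘ.≃-Reasoning
  cross : ∀ x y → (x ℤ.+ y) ℤ.* + 1 ≡ (x ℤ.* + 1 ℤ.+ y ℤ.* + 1) ℤ.* + 1
  cross = solve-∀

/-≡-*-1/[1+] : ∀ a b → + a / suc b ≡ fromℕ a *ℚ 1/[1+ b ]
/-≡-*-1/[1+] a b = toℚᵘ-injective (begin
  toℚᵘ (+ a / suc b)                      ≈⟨ toℚᵘ-/ a b ⟩
  mkℚᵘ (+ a) b                            ≈⟨ *≡* (cross (+ a) (+ suc b)) ⟩
  mkℚᵘ (+ a) 0 ℚᵘ.* mkℚᵘ (+ 1) b          ≈⟨ ℚᵘ.*-cong (toℚᵘ-/ a 0) (toℚᵘ-/ 1 b) ⟨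
  toℚᵘ (fromℕ a) ℚᵘ.* toℚᵘ 1/[1+ b ]      ≈⟨ toℚᵘ-homo-* (fromℕ a) 1/[1+ b ] ⟨
  toℚᵘ (fromℕ a *ℚ 1/[1+ b ])             ∎)
  where
  open ℚᵘ.≃-Reasoning
  cross : ∀ x y → x ℤ.* ((+ 1) ℤ.* y) ≡ (x ℤ.* + 1) ℤ.* y
  cross = solve-∀

fromℕ-suc-*-1/[1+] : ∀ k → fromℕ (suc k) *ℚ 1/[1+ k ] ≡ 1ℚ
fromℕ-suc-*-1/[1+] k = trans (sym (/-≡-*-1/[1+] (suc k) k))
  (toℚᵘ-injective (ℚᵘ.≃-trans (toℚᵘ-/ (suc k) k) (*≡* (ℤ.*-comm (+ suc k) (+ 1)))))

1/[1+]-recurrence : ∀ d k → 1/[1+ k ] ≡ (fromℕ (suc d) *ℚ 1/[1+ k ] +ℚ 1ℚ) *ℚ 1/[1+ suc (d + k) ]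
1/[1+]-recurrence d k = begin
  u                   ≡⟨ ℚ.*-identityʳ u ⟨
  u *ℚ 1ℚ             ≡⟨ cong (u *ℚ_) (fromℕ-suc-*-1/[1+] (suc (d + k))) ⟨
  u *ℚ (M *ℚ v)       ≡⟨ solve 3 (λ u M v → u :* (M :* v) := (M :* u) :* v) refl u M v ⟩
  (M *ℚ u) *ℚ v       ≡⟨ cong (_*ℚ v) M*u ⟩
  (fromℕ (suc d) *ℚ u +ℚ 1ℚ) *ℚ v ∎
  where
  open ≡-Reasoning
  u = 1/[1+ k ]
  v = 1/[1+ suc (d + k) ]
  M = fromℕ (suc (suc (d + k)))
  M*u : M *ℚ u ≡ fromℕ (suc d) *ℚ u +ℚ 1ℚ
  M*u = begin
    M *ℚ u                                   ≡⟨ cong (λ m → fromℕ m *ℚ u) (ℕ.+-suc (suc d) k) ⟨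
    fromℕ (suc d + suc k) *ℚ u               ≡⟨ cong (_*ℚ u) (fromℕ-+ (suc d) (suc k)) ⟩
    (fromℕ (suc d) +ℚ fromℕ (suc k)) *ℚ u    ≡⟨ ℚ.*-distribʳ-+ u (fromℕ (suc d)) (fromℕ (suc k)) ⟩
    fromℕ (suc d) *ℚ u +ℚ fromℕ (suc k) *ℚ u ≡⟨ cong (fromℕ (suc d) *ℚ u +ℚ_) (fromℕ-suc-*-1/[1+] k) ⟩
    fromℕ (suc d) *ℚ u +ℚ 1ℚ                 ∎

coeff : Poly → ℕ → ℚ
coeff []       i       = 0ℚ
coeff (a ∷ P)  zero    = a
coeff (a ∷ P)  (suc i) = coeff P i

infix 4 _≋_
record _≋_ (P R : Poly) : Set where
  constructor coeff-≡
  field coeff-≡-at : ∀ i → coeff P i ≡ coeff R i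
open _≋_

≋-setoid : Setoid _ _
≋-setoid = record
  { Carrier = Poly
  ; _≈_ = _≋_
  ; isEquivalence = record
    { refl  = coeff-≡ λ i → refl
    ; sym   = λ e → coeff-≡ λ i → sym (coeff-≡-at e i)
    ; trans = λ e f → coeff-≡ λ i → trans (coeff-≡-at e i) (coeff-≡-at f i)
    }
  }

open Setoid ≋-setoid using () renaming (refl to ≋-refl; sym to ≋-sym; trans to ≋-trans)

infixl 6 _⊕_
infixl 7 _·_

_⊕_ : Poly → Poly → Poly
[]      ⊕ R       = R
(a ∷ P) ⊕ []      = a ∷ P
(a ∷ P) ⊕ (b ∷ R) = a +ℚ b ∷ P ⊕ R

_·_ : ℚ → Poly → Poly
r · []      = []
r · (a ∷ P) = r *ℚ a ∷ r · P

coeff-⊕ : ∀ P R i → coeff (P ⊕ R) i ≡ coeff P i +ℚ coeff R i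
coeff-⊕ []      R       i       = sym (ℚ.+-identityˡ _)
coeff-⊕ (a ∷ P) []      i       = sym (ℚ.+-identityʳ _)
coeff-⊕ (a ∷ P) (b ∷ R) zero    = refl
coeff-⊕ (a ∷ P) (b ∷ R) (suc i) = coeff-⊕ P R i

coeff-· : ∀ r P i → coeff (r · P) i ≡ r *ℚ coeff P i
coeff-· r []      i       = sym (ℚ.*-zeroʳ r)
coeff-· r (a ∷ P) zero    = refl
coeff-· r (a ∷ P) (suc i) = coeff-· r P i

coeff-shift-< : ∀ {d i} P → i < d → coeff (shift d P) i ≡ 0ℚ
coeff-shift-< P (s≤s z≤n)       = refl
coeff-shift-< P (s≤s (s≤s i<d)) = coeff-shift-< P (s≤s i<d)

coeff-shift-+ : ∀ d P j → coeff (shift d P) (d + j) ≡ coeff P j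
coeff-shift-+ zero    P j = refl
coeff-shift-+ (suc d) P j = coeff-shift-+ d P j

⊕-cong : ∀ {P P′ R R′} → P ≋ P′ → R ≋ R′ → P ⊕ R ≋ P′ ⊕ R′
⊕-cong {P} {P′} {R} {R′} e f = coeff-≡ λ i → begin
  coeff (P ⊕ R) i             ≡⟨ coeff-⊕ P R i ⟩
  coeff P i +ℚ coeff R i      ≡⟨ cong₂ _+ℚ_ (coeff-≡-at e i) (coeff-≡-at f i) ⟩
  coeff P′ i +ℚ coeff R′ i    ≡⟨ coeff-⊕ P′ R′ i ⟨
  coeff (P′ ⊕ R′) i           ∎
  where open ≡-Reasoning

⊕-congˡ : ∀ P {R R′} → R ≋ R′ → P ⊕ R ≋ P ⊕ R′
⊕-congˡ P = ⊕-cong (≋-refl {P})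

⊕-congʳ : ∀ {P P′} R → P ≋ P′ → P ⊕ R ≋ P′ ⊕ R
⊕-congʳ R P≋P′ = ⊕-cong P≋P′ (≋-refl {R})

⊕-identityʳ : ∀ P → P ⊕ [] ≋ P
⊕-identityʳ P = coeff-≡ λ i → trans (coeff-⊕ P [] i) (ℚ.+-identityʳ (coeff P i))

⊕-assoc : ∀ P R S → (P ⊕ R) ⊕ S ≋ P ⊕ (R ⊕ S)
⊕-assoc P R S = coeff-≡ λ i → begin
  coeff ((P ⊕ R) ⊕ S) i                  ≡⟨ trans (coeff-⊕ (P ⊕ R) S i) (cong (_+ℚ coeff S i) (coeff-⊕ P R i)) ⟩
  (coeff P i +ℚ coeff R i) +ℚ coeff S i  ≡⟨ ℚ.+-assoc (coeff P i) (coeff R i) (coeff S i) ⟩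
  coeff P i +ℚ (coeff R i +ℚ coeff S i)  ≡⟨ trans (coeff-⊕ P (R ⊕ S) i) (cong (coeff P i +ℚ_) (coeff-⊕ R S i)) ⟨
  coeff (P ⊕ (R ⊕ S)) i                  ∎
  where open ≡-Reasoning

·-distribʳ-+ : ∀ r s P → (r +ℚ s) · P ≋ r · P ⊕ s · P
·-distribʳ-+ r s P = coeff-≡ λ i → begin
  coeff ((r +ℚ s) · P) i          ≡⟨ coeff-· (r +ℚ s) P i ⟩
  (r +ℚ s) *ℚ coeff P i           ≡⟨ ℚ.*-distribʳ-+ (coeff P i) r s ⟩
  r *ℚ coeff P i +ℚ s *ℚ coeff P i ≡⟨ cong₂ _+ℚ_ (coeff-· r P i) (coeff-· s P i) ⟨
  coeff (r · P) i +ℚ coeff (s · P) i ≡⟨ coeff-⊕ (r · P) (s · P) i ⟨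
  coeff (r · P ⊕ s · P) i         ∎
  where open ≡-Reasoning

[0]≋[] : ∀ {c} → c ≡ 0ℚ → c ∷ [] ≋ []
[0]≋[] c≡0 = coeff-≡ λ { zero → c≡0 ; (suc i) → refl }

shift-cong : ∀ n {P R} → P ≋ R → shift n P ≋ shift n R
shift-cong zero    e = e
shift-cong (suc n) e = coeff-≡ λ { zero → refl ; (suc i) → coeff-≡-at (shift-cong n e) i }

shift-⊕ : ∀ n P R → shift n (P ⊕ R) ≋ shift n P ⊕ shift n R
shift-⊕ zero    P R = ≋-refl
shift-⊕ (suc n) P R = coeff-≡ λ { zero → sym (ℚ.+-identityˡ 0ℚ) ; (suc i) → coeff-≡-at (shift-⊕ n P R) i }

shift-· : ∀ n r P → shift n (r · P) ≋ r · shift n P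
shift-· zero    r P = ≋-refl
shift-· (suc n) r P = coeff-≡ λ { zero → sym (ℚ.*-zeroʳ r) ; (suc i) → coeff-≡-at (shift-· n r P) i }

shift-[] : ∀ n → shift n [] ≋ []
shift-[] zero    = ≋-refl
shift-[] (suc n) = coeff-≡ λ { zero → refl ; (suc i) → coeff-≡-at (shift-[] n) i }

shift-shift : ∀ m n P → shift m (shift n P) ≡ shift (m + n) P
shift-shift zero    n P = refl
shift-shift (suc m) n P = cong (0ℚ ∷_) (shift-shift m n P)

coeff-drop-1 : ∀ R i → coeff (drop 1 R) i ≡ coeff R (suc i)
coeff-drop-1 []      i = refl
coeff-drop-1 (a ∷ R) i = refl

eval-[]≋ : ∀ {R} x → [] ≋ R → eval R x ≡ 0ℚ
eval-[]≋ {[]}    x e = refl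
eval-[]≋ {b ∷ R} x e = begin
  b +ℚ x *ℚ eval R x   ≡⟨ cong₂ (λ u v → u +ℚ x *ℚ v) (sym (coeff-≡-at e 0)) (eval-[]≋ {R} x (coeff-≡ λ i → coeff-≡-at e (suc i))) ⟩
  0ℚ +ℚ x *ℚ 0ℚ        ≡⟨ solve 1 (λ x → con 0ℚ :+ x :* con 0ℚ := con 0ℚ) refl x ⟩
  0ℚ                   ∎
  where open ≡-Reasoning

eval-cong : ∀ {P R} x → P ≋ R → eval P x ≡ eval R x
eval-cong {[]}    x e = sym (eval-[]≋ x e)
eval-cong {a ∷ P} {[]} x e = eval-[]≋ x (≋-sym e)
eval-cong {a ∷ P} {b ∷ R} x e =
  cong₂ (λ u v → u +ℚ x *ℚ v) (coeff-≡-at e 0) (eval-cong {P} {R} x (coeff-≡ λ i → coeff-≡-at e (suc i)))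

eval-∷ : ∀ R x → eval R x ≡ coeff R 0 +ℚ x *ℚ eval (drop 1 R) x
eval-∷ []      x = solve 1 (λ x → con 0ℚ := con 0ℚ :+ x :* con 0ℚ) refl x
eval-∷ (a ∷ R) x = refl

eval-⊕ : ∀ P R x → eval (P ⊕ R) x ≡ eval P x +ℚ eval R x
eval-⊕ []      R       x = sym (ℚ.+-identityˡ _)
eval-⊕ (a ∷ P) []      x = sym (ℚ.+-identityʳ _)
eval-⊕ (a ∷ P) (b ∷ R) x = trans (cong (λ v → (a +ℚ b) +ℚ x *ℚ v) (eval-⊕ P R x))
  (solve 5 (λ a b x u v → (a :+ b) :+ x :* (u :+ v) := (a :+ x :* u) :+ (b :+ x :* v)) refl a b x (eval P x) (eval R x))

eval-· : ∀ r P x → eval (r · P) x ≡ r *ℚ eval P x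
eval-· r []      x = sym (ℚ.*-zeroʳ r)
eval-· r (a ∷ P) x = trans (cong (λ v → r *ℚ a +ℚ x *ℚ v) (eval-· r P x))
  (solve 4 (λ r a x u → r :* a :+ x :* (r :* u) := r :* (a :+ x :* u)) refl r a x (eval P x))

eval-shift : ∀ n P x → eval (shift n P) x ≡ pow x n *ℚ eval P x
eval-shift zero    P x = sym (ℚ.*-identityˡ _)
eval-shift (suc n) P x = trans (cong (λ v → 0ℚ +ℚ x *ℚ v) (eval-shift n P x))
  (solve 3 (λ x p e → con 0ℚ :+ x :* (p :* e) := (x :* p) :* e) refl x (pow x n) (eval P x))

eval-lincomb : ∀ s P r R x → eval (s · P ⊕ r · R) x ≡ s *ℚ eval P x +ℚ r *ℚ eval R x
eval-lincomb s P r R x = trans (eval-⊕ (s · P) (r · R) x) (cong₂ _+ℚ_ (eval-· s P x) (eval-· r R x))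

HasDerivative : Poly → Poly → Set
HasDerivative F P = ∀ i → coeff F (suc i) ≡ coeff P i *ℚ 1/[1+ i ]

const-hasDerivative : ∀ c → HasDerivative (c ∷ []) []
const-hasDerivative c i = sym (ℚ.*-zeroˡ 1/[1+ i ])

coeff-antiFrom : ∀ k P i → coeff (antiFrom k P) i ≡ coeff P i *ℚ 1/[1+ k + i ]
coeff-antiFrom k []      i       = sym (ℚ.*-zeroˡ 1/[1+ k + i ])
coeff-antiFrom k (a ∷ P) zero    = cong (λ m → a *ℚ 1/[1+ m ]) (sym (ℕ.+-identityʳ k))
coeff-antiFrom k (a ∷ P) (suc i) =
  trans (coeff-antiFrom (suc k) P i) (cong (λ m → coeff P i *ℚ 1/[1+ m ]) (sym (ℕ.+-suc k i)))

integ-hasDerivative : ∀ q P → HasDerivative (integ q P) P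
integ-hasDerivative q P = coeff-antiFrom 0 P

eval-integ : ∀ q P → eval (integ q P) q ≡ 0ℚ
eval-integ q P =
  solve 2 (λ q A → (con 0ℚ :- (con 0ℚ :+ q :* A)) :+ q :* A := con 0ℚ) refl q (eval (antiFrom 0 P) q)

antiderivative-≋ : ∀ q {F P} → HasDerivative F P → F ≋ integ q P ⊕ (eval F q ∷ [])
antiderivative-≋ q {F} {P} F′≡P = coeff-≡ λ
  { zero    → constant-term
  ; (suc i) → trans (F′≡P i) (sym (trans (coeff-⊕ (integ q P) (eval F q ∷ []) (suc i))
                (trans (ℚ.+-identityʳ _) (integ-hasDerivative q P i))))
  }
  where
  A = eval (antiFrom 0 P) q
  c = 0ℚ -ℚ (0ℚ +ℚ q *ℚ A)
  tail≋ : drop 1 F ≋ antiFrom 0 P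
  tail≋ = coeff-≡ λ i → trans (coeff-drop-1 F i) (trans (F′≡P i) (sym (coeff-antiFrom 0 P i)))
  constant-term : coeff F 0 ≡ c +ℚ eval F q
  constant-term = begin
    coeff F 0
      ≡⟨ solve 3 (λ r q A → r := (con 0ℚ :- (con 0ℚ :+ q :* A)) :+ (r :+ q :* A)) refl (coeff F 0) q A ⟩
    c +ℚ (coeff F 0 +ℚ q *ℚ A)                  ≡⟨ cong (λ v → c +ℚ (coeff F 0 +ℚ q *ℚ v)) (eval-cong q tail≋) ⟨
    c +ℚ (coeff F 0 +ℚ q *ℚ eval (drop 1 F) q)  ≡⟨ cong (c +ℚ_) (eval-∷ F q) ⟨
    c +ℚ eval F q                               ∎
    where open ≡-Reasoning

product-rule : ∀ d {F P} → HasDerivative F P →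
  HasDerivative (shift (suc d) F) (fromℕ (suc d) · shift d F ⊕ shift (suc d) P)
product-rule d {F} {P} F′≡P i = trans (product-rule-coeff i)
  (cong (_*ℚ 1/[1+ i ]) (sym (trans (coeff-⊕ (n · shift d F) (shift (suc d) P) i)
                                    (cong (_+ℚ coeff (shift (suc d) P) i) (coeff-· n (shift d F) i)))))
  where
  n = fromℕ (suc d)
  product-rule-coeff : ∀ i →
    coeff (shift d F) i ≡ (n *ℚ coeff (shift d F) i +ℚ coeff (shift (suc d) P) i) *ℚ 1/[1+ i ]
  product-rule-coeff i with compare d i
  ... | less .d k = begin
    c                                          ≡⟨ c≡ ⟩
    p *ℚ u                                     ≡⟨ cong (p *ℚ_) (1/[1+]-recurrence d k) ⟩
    p *ℚ ((n *ℚ u +ℚ 1ℚ) *ℚ v)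
      ≡⟨ solve 4 (λ p n u v → p :* ((n :* u :+ con 1ℚ) :* v) := (n :* (p :* u) :+ p) :* v) refl p n u v ⟩
    (n *ℚ (p *ℚ u) +ℚ p) *ℚ v                  ≡⟨ cong₂ (λ y z → (n *ℚ y +ℚ z) *ℚ v) c≡ (coeff-shift-+ d P k) ⟨
    (n *ℚ c +ℚ coeff (shift d P) (d + k)) *ℚ v ∎
    where
    open ≡-Reasoning
    c = coeff (shift d F) (suc (d + k))
    p = coeff P k
    u = 1/[1+ k ]
    v = 1/[1+ suc (d + k) ]
    c≡ : c ≡ p *ℚ u
    c≡ = trans (cong (coeff (shift d F)) (sym (ℕ.+-suc d k))) (trans (coeff-shift-+ d F (suc k)) (F′≡P k))
  ... | equal .d = begin
    c                                          ≡⟨ ℚ.*-identityʳ c ⟨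
    c *ℚ 1ℚ                                    ≡⟨ cong (c *ℚ_) (fromℕ-suc-*-1/[1+] d) ⟨
    c *ℚ (n *ℚ v)                              ≡⟨ solve 3 (λ c n v → c :* (n :* v) := (n :* c :+ con 0ℚ) :* v) refl c n v ⟩
    (n *ℚ c +ℚ 0ℚ) *ℚ v                        ≡⟨ cong (λ z → (n *ℚ c +ℚ z) *ℚ v) (coeff-shift-< P (ℕ.n<1+n d)) ⟨
    (n *ℚ c +ℚ coeff (shift (suc d) P) d) *ℚ v ∎
    where
    open ≡-Reasoning
    c = coeff (shift d F) d
    v = 1/[1+ d ]
  ... | greater .i k = begin
    c                                          ≡⟨ c≡0 ⟩
    0ℚ                                         ≡⟨ solve 2 (λ n v → con 0ℚ := (n :* con 0ℚ :+ con 0ℚ) :* v) refl n v ⟩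
    (n *ℚ 0ℚ +ℚ 0ℚ) *ℚ v                       ≡⟨ cong₂ (λ y z → (n *ℚ y +ℚ z) *ℚ v) c≡0 (coeff-shift-< P (ℕ.m<n⇒m<1+n i<d)) ⟨
    (n *ℚ c +ℚ coeff (shift (suc d) P) i) *ℚ v ∎
    where
    open ≡-Reasoning
    i<d : i < suc (i + k)
    i<d = s≤s (ℕ.m≤m+n i k)
    c = coeff (shift (suc (i + k)) F) i
    v = 1/[1+ i ]
    c≡0 : c ≡ 0ℚ
    c≡0 = coeff-shift-< F i<d

module _ (q : ℚ) where

  integ-unique : ∀ {F P} → HasDerivative F P → eval F q ≡ 0ℚ → F ≋ integ q P
  integ-unique {F} {P} F′≡P F[q]≡0 = begin
    F                            ≈⟨ antiderivative-≋ q F′≡P ⟩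
    integ q P ⊕ (eval F q ∷ [])  ≈⟨ ⊕-congˡ (integ q P) ([0]≋[] F[q]≡0) ⟩
    integ q P ⊕ []               ≈⟨ ⊕-identityʳ (integ q P) ⟩
    integ q P                    ∎
    where open SetoidReasoning ≋-setoid

  integ-cong : ∀ {P R} → P ≋ R → integ q P ≋ integ q R
  integ-cong {P} {R} P≋R = integ-unique
    (λ i → trans (integ-hasDerivative q P i) (cong (_*ℚ 1/[1+ i ]) (coeff-≡-at P≋R i)))
    (eval-integ q P)

  integ-⊕ : ∀ P R → integ q (P ⊕ R) ≋ integ q P ⊕ integ q R
  integ-⊕ P R = ≋-sym (integ-unique derivative vanishes)
    where
    vanishes : eval (integ q P ⊕ integ q R) q ≡ 0ℚ
    vanishes = trans (eval-⊕ (integ q P) (integ q R) q)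
      (trans (cong₂ _+ℚ_ (eval-integ q P) (eval-integ q R)) (ℚ.+-identityˡ 0ℚ))
    derivative : HasDerivative (integ q P ⊕ integ q R) (P ⊕ R)
    derivative i = begin
      coeff (integ q P ⊕ integ q R) (suc i)                   ≡⟨ coeff-⊕ (integ q P) (integ q R) (suc i) ⟩
      coeff (integ q P) (suc i) +ℚ coeff (integ q R) (suc i)  ≡⟨ cong₂ _+ℚ_ (integ-hasDerivative q P i) (integ-hasDerivative q R i) ⟩
      coeff P i *ℚ 1/[1+ i ] +ℚ coeff R i *ℚ 1/[1+ i ]        ≡⟨ ℚ.*-distribʳ-+ 1/[1+ i ] (coeff P i) (coeff R i) ⟨
      (coeff P i +ℚ coeff R i) *ℚ 1/[1+ i ]                   ≡⟨ cong (_*ℚ 1/[1+ i ]) (coeff-⊕ P R i) ⟨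
      coeff (P ⊕ R) i *ℚ 1/[1+ i ]                            ∎
      where open ≡-Reasoning

  integ-· : ∀ r P → integ q (r · P) ≋ r · integ q P
  integ-· r P = ≋-sym (integ-unique derivative vanishes)
    where
    vanishes : eval (r · integ q P) q ≡ 0ℚ
    vanishes = trans (eval-· r (integ q P) q) (trans (cong (r *ℚ_) (eval-integ q P)) (ℚ.*-zeroʳ r))
    derivative : HasDerivative (r · integ q P) (r · P)
    derivative i = begin
      coeff (r · integ q P) (suc i)      ≡⟨ coeff-· r (integ q P) (suc i) ⟩
      r *ℚ coeff (integ q P) (suc i)     ≡⟨ cong (r *ℚ_) (integ-hasDerivative q P i) ⟩
      r *ℚ (coeff P i *ℚ 1/[1+ i ])      ≡⟨ ℚ.*-assoc r (coeff P i) 1/[1+ i ] ⟨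
      r *ℚ coeff P i *ℚ 1/[1+ i ]        ≡⟨ cong (_*ℚ 1/[1+ i ]) (coeff-· r P i) ⟨
      coeff (r · P) i *ℚ 1/[1+ i ]       ∎
      where open ≡-Reasoning

  integ-by-parts : ∀ d P →
    fromℕ (suc d) · integ q (shift d (integ q P)) ⊕ integ q (shift (suc d) P) ≋ shift (suc d) (integ q P)
  integ-by-parts d P = begin
    n · integ q (shift d F) ⊕ integ q (shift (suc d) P)  ≈⟨ ⊕-congʳ (integ q (shift (suc d) P)) (integ-· n (shift d F)) ⟨
    integ q (n · shift d F) ⊕ integ q (shift (suc d) P)  ≈⟨ integ-⊕ (n · shift d F) (shift (suc d) P) ⟨
    integ q (n · shift d F ⊕ shift (suc d) P)            ≈⟨ integ-unique (product-rule d (integ-hasDerivative q P)) vanishes ⟨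
    shift (suc d) F                                      ∎
    where
    open SetoidReasoning ≋-setoid
    F = integ q P
    n = fromℕ (suc d)
    vanishes : eval (shift (suc d) F) q ≡ 0ℚ
    vanishes = trans (eval-shift (suc d) F q) (trans (cong (pow q (suc d) *ℚ_) (eval-integ q P)) (ℚ.*-zeroʳ (pow q (suc d))))

  I : ℕ → Poly → Poly
  I d P = iterStep q P d

  I-lincomb : ∀ d {s r P R S} → s · P ⊕ r · R ≋ S → s · I d P ⊕ r · I d R ≋ I d S
  I-lincomb d {s} {r} {P} {R} {S} h = begin
    s · I d P ⊕ r · I d R                         ≈⟨ ⊕-cong (integ-· s (shift D P)) (integ-· r (shift D R)) ⟨
    integ q (s · shift D P) ⊕ integ q (r · shift D R)  ≈⟨ integ-⊕ (s · shift D P) (r · shift D R) ⟨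
    integ q (s · shift D P ⊕ r · shift D R)       ≈⟨ integ-cong (⊕-cong (shift-· D s P) (shift-· D r R)) ⟨
    integ q (shift D (s · P) ⊕ shift D (r · R))   ≈⟨ integ-cong (shift-⊕ D (s · P) (r · R)) ⟨
    I d (s · P ⊕ r · R)                           ≈⟨ integ-cong (shift-cong D h) ⟩
    I d S                                         ∎
    where
    open SetoidReasoning ≋-setoid
    D = d ∸ 1

  iterate-lincomb : ∀ ds {s r P R S} → s · P ⊕ r · R ≋ S →
    s · foldl (iterStep q) P ds ⊕ r · foldl (iterStep q) R ds ≋ foldl (iterStep q) S ds
  iterate-lincomb []       h = h
  iterate-lincomb (d ∷ ds) h = iterate-lincomb ds (I-lincomb d h)

  I-by-parts : ∀ {d e} P → 0 < d → 0 < e → fromℕ d · I d (I e P) ⊕ I d (shift e P) ≋ shift d (I e P)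
  I-by-parts {suc d} {suc e} P (s≤s z≤n) (s≤s z≤n) =
    subst (λ S → fromℕ (suc d) · I (suc d) (I (suc e) P) ⊕ integ q S ≋ shift (suc d) (I (suc e) P))
          shift-suc-comm (integ-by-parts d (shift e P))
    where
    shift-suc-comm : shift (suc d) (shift e P) ≡ shift d (shift (suc e) P)
    shift-suc-comm = trans (shift-shift (suc d) e P)
      (trans (cong (λ m → shift m P) (sym (ℕ.+-suc d e))) (sym (shift-shift d (suc e) P)))

  I-shift : ∀ x {y} P → 0 < y → I y (shift x P) ≡ I (x + y) P
  I-shift x {suc y} P (s≤s z≤n) = cong (integ q) (trans (shift-shift y x P)
    (cong (λ m → shift m P) (trans (ℕ.+-comm y x) (cong (_∸ 1) (sym (ℕ.+-suc x y))))))

  euler-monomial : ∀ {d} → 0 < d → fromℕ d · I d (1ℚ ∷ []) ⊕ pow q d · (1ℚ ∷ []) ≋ shift d (1ℚ ∷ [])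
  euler-monomial {suc d} (s≤s z≤n) = begin
    n · integ q M ⊕ (pow q (suc d) *ℚ 1ℚ ∷ [])              ≈⟨ ⊕-congʳ (pow q (suc d) *ℚ 1ℚ ∷ []) (integ-· n M) ⟨
    integ q (n · M) ⊕ (pow q (suc d) *ℚ 1ℚ ∷ [])            ≈⟨ ⊕-congʳ (pow q (suc d) *ℚ 1ℚ ∷ []) (integ-cong derivative≋) ⟨
    integ q (n · M ⊕ shift (suc d) []) ⊕ (pow q (suc d) *ℚ 1ℚ ∷ [])
      ≡⟨ cong (λ c → integ q (n · M ⊕ shift (suc d) []) ⊕ (c ∷ [])) value ⟩
    integ q (n · M ⊕ shift (suc d) []) ⊕ (eval (shift (suc d) (1ℚ ∷ [])) q ∷ [])
      ≈⟨ antiderivative-≋ q (product-rule d (const-hasDerivative 1ℚ)) ⟨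
    shift (suc d) (1ℚ ∷ [])                                 ∎
    where
    open SetoidReasoning ≋-setoid
    n = fromℕ (suc d)
    M = shift d (1ℚ ∷ [])
    derivative≋ : n · M ⊕ shift (suc d) [] ≋ n · M
    derivative≋ = ≋-trans (⊕-congˡ (n · M) (shift-[] (suc d))) (⊕-identityʳ (n · M))
    value : pow q (suc d) *ℚ 1ℚ ≡ eval (shift (suc d) (1ℚ ∷ [])) q
    value = trans (cong (pow q (suc d) *ℚ_) (solve 1 (λ q → con 1ℚ := con 1ℚ :+ q :* con 0ℚ) refl q))
                  (sym (eval-shift (suc d) (1ℚ ∷ []) q))

  -- Apply I d to the hypothesis and add d · I d (I e P), which integration by parts turns into
  -- shift d (I e P) − I d (shift e P).
  euler-step : ∀ {P e T n Q} d → 0 < e → 0 < d → fromℕ n · I e P ⊕ Q · T ≋ shift e P →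
               fromℕ (n + d) · I d (I e P) ⊕ Q · I d T ≋ shift d (I e P)
  euler-step {P} {e} {T} {n} {Q} d 0<e 0<d h = begin
    fromℕ (n + d) · X ⊕ Q · Y              ≡⟨ cong (λ s → s · X ⊕ Q · Y) (trans (cong fromℕ (ℕ.+-comm n d)) (fromℕ-+ d n)) ⟩
    (fromℕ d +ℚ fromℕ n) · X ⊕ Q · Y       ≈⟨ ⊕-congʳ (Q · Y) (·-distribʳ-+ (fromℕ d) (fromℕ n) X) ⟩
    fromℕ d · X ⊕ fromℕ n · X ⊕ Q · Y      ≈⟨ ⊕-assoc (fromℕ d · X) (fromℕ n · X) (Q · Y) ⟩
    fromℕ d · X ⊕ (fromℕ n · X ⊕ Q · Y)    ≈⟨ ⊕-congˡ (fromℕ d · X) (I-lincomb d h) ⟩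
    fromℕ d · X ⊕ I d (shift e P)          ≈⟨ I-by-parts P 0<d 0<e ⟩
    shift d (I e P)                        ∎
    where
    open SetoidReasoning ≋-setoid
    X = I d (I e P)
    Y = I d T

  euler-iterate : ∀ as x {P e T n Q} → 0 < e → All (0 <_) (as ∷ʳ x) → fromℕ n · I e P ⊕ Q · T ≋ shift e P →
    fromℕ (foldl _+_ n (as ∷ʳ x)) · foldl (iterStep q) (I e P) (as ∷ʳ x) ⊕ Q · foldl (iterStep q) T (as ∷ʳ x)
      ≋ shift x (foldl (iterStep q) (I e P) as)
  euler-iterate []       x {n = n} 0<e (0<x ∷ [])  h = euler-step {n = n} x 0<e 0<x h
  euler-iterate (d ∷ as) x {n = n} 0<e (0<d ∷ pos) h =
    euler-iterate as x {n = n + d} 0<d pos (euler-step {n = n} d 0<e 0<d h)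

  -- The weight foldl _+_ 0 (a ∷ʳ x) is sum (a ∷ʳ x) (foldl-+), accumulated in the order in which
  -- euler-iterate adds the parts.
  euler-identity : ∀ a x → All (0 <_) (a ∷ʳ x) →
    fromℕ (foldl _+_ 0 (a ∷ʳ x)) · H q (a ∷ʳ x) ⊕ pow q (headD (a ∷ʳ x)) · H q (cL (a ∷ʳ x)) ≋ shift x (H q a)
  euler-identity []      x (0<x ∷ [])  = euler-monomial 0<x
  euler-identity (e ∷ a) x (0<e ∷ pos) = euler-iterate a x 0<e pos (euler-monomial 0<e)

foldl-+ : ∀ n l → foldl _+_ n l ≡ n + sum l
foldl-+ n []      = sym (ℕ.+-identityʳ n)
foldl-+ n (m ∷ l) = trans (foldl-+ (n + m) l) (ℕ.+-assoc n m (sum l))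

take-length-++ : ∀ {A : Set} (p l : List A) → take (length p) (p ++ l) ≡ p
take-length-++ []      l = refl
take-length-++ (z ∷ p) l = cong (z ∷_) (take-length-++ p l)

cR-∷ʳ : ∀ p (d : ℕ) → cR (p ∷ʳ d) ≡ p
cR-∷ʳ p d = trans (cong (λ m → take m (p ∷ʳ d)) (trans (cong (_∸ 1) (length-++ p)) (ℕ.m+n∸n≡m (length p) 1)))
                  (take-length-++ p (d ∷ []))

cL-++ : ∀ a (x : ℕ) l → cL (a ++ x ∷ l) ≡ cL (a ∷ʳ x) ++ l
cL-++ []      x l = refl
cL-++ (z ∷ a) x l = sym (++-assoc a (x ∷ []) l)

headD-++ : ∀ a (x : ℕ) l → headD (a ++ x ∷ l) ≡ headD (a ∷ʳ x)
headD-++ []      x l = refl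
headD-++ (z ∷ a) x l = refl

pow-1ℚ : ∀ d → pow 1ℚ d ≡ 1ℚ
pow-1ℚ zero    = refl
pow-1ℚ (suc d) = trans (ℚ.*-identityˡ (pow 1ℚ d)) (pow-1ℚ d)

H-++ : ∀ q l m → H q (l ++ m) ≡ foldl (iterStep q) (H q l) m
H-++ q = foldl-++ (iterStep q) (1ℚ ∷ [])

g-euler : ∀ q c → All (0 <_) c → fromℕ (sum c) *ℚ g c q +ℚ pow q (headD c) *ℚ g (cL c) q ≡ g (cR c) q
g-euler q c pos with initLast c
... | []      = refl
... | p ∷ʳ′ d = begin
  fromℕ (sum (p ∷ʳ d)) *ℚ g (p ∷ʳ d) q +ℚ Q *ℚ g (cL (p ∷ʳ d)) q
    ≡⟨ cong (λ m → fromℕ m *ℚ g (p ∷ʳ d) q +ℚ Q *ℚ g (cL (p ∷ʳ d)) q) (foldl-+ 0 (p ∷ʳ d)) ⟨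
  fromℕ (foldl _+_ 0 (p ∷ʳ d)) *ℚ g (p ∷ʳ d) q +ℚ Q *ℚ g (cL (p ∷ʳ d)) q
    ≡⟨ eval-lincomb (fromℕ (foldl _+_ 0 (p ∷ʳ d))) (H q (p ∷ʳ d)) Q (H q (cL (p ∷ʳ d))) 1ℚ ⟨
  eval (fromℕ (foldl _+_ 0 (p ∷ʳ d)) · H q (p ∷ʳ d) ⊕ Q · H q (cL (p ∷ʳ d))) 1ℚ
    ≡⟨ eval-cong 1ℚ (euler-identity q p d pos) ⟩
  eval (shift d (H q p)) 1ℚ  ≡⟨ eval-shift d (H q p) 1ℚ ⟩
  pow 1ℚ d *ℚ g p q          ≡⟨ cong (_*ℚ g p q) (pow-1ℚ d) ⟩
  1ℚ *ℚ g p q                ≡⟨ ℚ.*-identityˡ (g p q) ⟩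
  g p q                      ≡⟨ cong (λ l → g l q) (cR-∷ʳ p d) ⟨
  g (cR (p ∷ʳ d)) q          ∎
  where
  open ≡-Reasoning
  Q = pow q (headD (p ∷ʳ d))

-- Integrate the identity for a ∷ʳ x further along y ∷ b; on its right-hand side the first step
-- merges t^x with t^{y-1} (I-shift).
g-merge : ∀ q a x y b → All (0 <_) (a ++ x ∷ y ∷ b) →
  fromℕ (sum a + x) *ℚ g (a ++ x ∷ y ∷ b) q +ℚ pow q (headD (a ++ x ∷ y ∷ b)) *ℚ g (cL (a ++ x ∷ y ∷ b)) q
    ≡ g (a ++ (x + y) ∷ b) q
g-merge q a x y b pos = begin
  fromℕ (sum a + x) *ℚ g c q +ℚ pow q (headD c) *ℚ g (cL c) q
    ≡⟨ cong₂ (λ m h → fromℕ m *ℚ g c q +ℚ pow q h *ℚ g (cL c) q) weight (headD-++ a x (y ∷ b)) ⟩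
  n *ℚ eval (H q c) 1ℚ +ℚ Q *ℚ eval (H q (cL c)) 1ℚ
    ≡⟨ cong₂ (λ A B → n *ℚ eval A 1ℚ +ℚ Q *ℚ eval B 1ℚ) H-c H-cL ⟩
  n *ℚ eval A 1ℚ +ℚ Q *ℚ eval B 1ℚ  ≡⟨ eval-lincomb n A Q B 1ℚ ⟨
  eval (n · A ⊕ Q · B) 1ℚ            ≡⟨ eval-cong 1ℚ (iterate-lincomb q (y ∷ b) (euler-identity q a x pos-ax)) ⟩
  eval (foldl (iterStep q) (shift x (H q a)) (y ∷ b)) 1ℚ
    ≡⟨ cong (λ P → eval (foldl (iterStep q) P b) 1ℚ) (I-shift q x (H q a) 0<y) ⟩
  eval (foldl (iterStep q) (I q (x + y) (H q a)) b) 1ℚ ≡⟨ cong (λ P → eval P 1ℚ) (H-++ q a ((x + y) ∷ b)) ⟨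
  g (a ++ (x + y) ∷ b) q             ∎
  where
  open ≡-Reasoning
  c = a ++ x ∷ y ∷ b
  n = fromℕ (foldl _+_ 0 (a ∷ʳ x))
  Q = pow q (headD (a ∷ʳ x))
  A = foldl (iterStep q) (H q (a ∷ʳ x)) (y ∷ b)
  B = foldl (iterStep q) (H q (cL (a ∷ʳ x))) (y ∷ b)
  pos-ax : All (0 <_) (a ∷ʳ x)
  pos-ax = ∷ʳ⁺ (++⁻ˡ a pos) (All.head (++⁻ʳ a pos))
  0<y : 0 < y
  0<y = All.head (All.tail (++⁻ʳ a pos))
  weight : sum a + x ≡ foldl _+_ 0 (a ∷ʳ x)
  weight = sym (trans (foldl-+ 0 (a ∷ʳ x)) (trans (sum-++ a (x ∷ [])) (cong (λ m → sum a + m) (ℕ.+-identityʳ x))))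
  H-c : H q c ≡ A
  H-c = trans (cong (H q) (sym (++-assoc a (x ∷ []) (y ∷ b)))) (H-++ q (a ∷ʳ x) (y ∷ b))
  H-cL : H q (cL c) ≡ B
  H-cL = trans (cong (H q) (cL-++ a x (y ∷ b))) (H-++ q (cL (a ∷ʳ x)) (y ∷ b))

eliminate : ∀ {s t n} (u l v w : ℚ) → n ≡ s + t → 0 < s →
  fromℕ s *ℚ u +ℚ l ≡ v → fromℕ n *ℚ u +ℚ l ≡ w → v ≡ frac s n *ℚ w +ℚ frac t n *ℚ l
eliminate {suc s} {t} u l v w refl (s≤s z≤n) su+l≡v nu+l≡w = begin
  v                                 ≡⟨ su+l≡v ⟨
  S *ℚ u +ℚ l                       ≡⟨ ℚ.*-identityʳ _ ⟨
  (S *ℚ u +ℚ l) *ℚ 1ℚ               ≡⟨ cong ((S *ℚ u +ℚ l) *ℚ_) (fromℕ-suc-*-1/[1+] (s + t)) ⟨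
  (S *ℚ u +ℚ l) *ℚ (N *ℚ r)         ≡⟨ cong (λ z → (S *ℚ u +ℚ l) *ℚ (z *ℚ r)) N≡S+T ⟩
  (S *ℚ u +ℚ l) *ℚ ((S +ℚ T) *ℚ r)
    ≡⟨ solve 5 (λ S T u l r → (S :* u :+ l) :* ((S :+ T) :* r) := S :* r :* ((S :+ T) :* u :+ l) :+ T :* r :* l) refl S T u l r ⟩
  S *ℚ r *ℚ ((S +ℚ T) *ℚ u +ℚ l) +ℚ T *ℚ r *ℚ l
    ≡⟨ cong (λ z → S *ℚ r *ℚ (z *ℚ u +ℚ l) +ℚ T *ℚ r *ℚ l) N≡S+T ⟨
  S *ℚ r *ℚ (N *ℚ u +ℚ l) +ℚ T *ℚ r *ℚ l ≡⟨ cong (λ z → S *ℚ r *ℚ z +ℚ T *ℚ r *ℚ l) nu+l≡w ⟩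
  S *ℚ r *ℚ w +ℚ T *ℚ r *ℚ l        ≡⟨ cong₂ (λ y z → y *ℚ w +ℚ z *ℚ l) (/-≡-*-1/[1+] (suc s) (s + t)) (/-≡-*-1/[1+] t (s + t)) ⟨
  frac (suc s) (suc s + t) *ℚ w +ℚ frac t (suc s + t) *ℚ l ∎
  where
  open ≡-Reasoning
  S = fromℕ (suc s)
  T = fromℕ t
  N = fromℕ (suc s + t)
  r = 1/[1+ s + t ]
  N≡S+T : N ≡ S +ℚ T
  N≡S+T = fromℕ-+ (suc s) t

corollary7p4 : (a b : List ℕ) (x y : ℕ) →
    All (0 <_) (a ++ x ∷ y ∷ b) →
    (q : ℚ) →
    g (a ++ (x + y) ∷ b) q
      ≡ (frac (sum a + x) (sum (a ++ x ∷ y ∷ b)) *ℚ g (cR (a ++ x ∷ y ∷ b)) q)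
        +ℚ (frac (y + sum b) (sum (a ++ x ∷ y ∷ b))
              *ℚ (pow q (headD (a ++ x ∷ y ∷ b)) *ℚ g (cL (a ++ x ∷ y ∷ b)) q))
corollary7p4 a b x y pos q =
  eliminate (g c q) (pow q (headD c) *ℚ g (cL c) q) (g (a ++ (x + y) ∷ b) q) (g (cR c) q)
    sum-c 0<sum-a+x (g-merge q a x y b pos) (g-euler q c pos)
  where
  c = a ++ x ∷ y ∷ b
  sum-c : sum c ≡ (sum a + x) + (y + sum b)
  sum-c = trans (sum-++ a (x ∷ y ∷ b)) (sym (ℕ.+-assoc (sum a) x (y + sum b)))
  0<sum-a+x : 0 < sum a + x
  0<sum-a+x = ℕ.<-≤-trans (All.head (++⁻ʳ a pos)) (ℕ.m≤n+m x (sum a))
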